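{- Let $\nu\in\mathcal{E}$ in expanded indexing $(\nu_1,\ldots,\nu_{p+2s})$ with index sets $I,J$, and let $\theta_x$ ($1\le x\le p+2s$) be the position in $\Psi(\nu)$ of the primary part originating from $\nu_x$. Then for all $i,i'\in I$ and $j,j'\in J$: (a) if $i<i'$, then either $\theta_i<\theta_{i+1}<\theta_{i'}<\theta_{i'+1}$ or $\theta_{i'}<\theta_i<\theta_{i+1}<\theta_{i'+1}$; (b) if $j<j'$, then $\theta_j<\theta_{j'}$; (c) $i+1\le\theta_{i+1}$ and $\theta_j\le j$; (d) either $\theta_j<\theta_i$ or $\theta_{i+1}<\theta_j$.
   Context: Primary colors $a_1<\cdots<a_n$; secondary colors $a_ia_j$ ($i<j$); total order $a_1a_2<\cdots<a_1a_n<a_1<a_2a_3<\cdots<a_2a_n<a_2<\cdots<a_{n-1}a_n<a_{n-1}<a_n$. A part $k_p$ has integer size $k$ and color $p$; $k_p+m=(k+m)_p$. $k_p\succ l_q$ iff $k-l\ge\chi(p\le q)$; $\succeq$ means $\succ$ or equal. Special pairs: $(a_ka_l,a_ia_j)$ with $i<j<k<l$ or $k<i<j<l$. $\mathcal{P}$: primary-colored parts of positive size; $\mathcal{S}$: secondary-colored parts of size $\ge2$. $k_p\gg l_q$ iff $k_p\succeq(l+1)_q$ when $p$ or $q$ primary; $k_p\succ(l+1)_q$ when both secondary and not special; $k_p\succ l_q$ when special. $\mathcal{E}$: finite sequences $\nu_1\gg\cdots\gg\nu_t$ in $\mathcal{P}\sqcup\mathcal{S}$. Halves: $\alpha((2k)_{a_ia_j})=k_{a_j}$,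 $\beta((2k)_{a_ia_j})=k_{a_i}$, $\alpha((2k+1)_{a_ia_j})=(k+1)_{a_i}$, $\beta((2k+1)_{a_ia_j})=k_{a_j}$. Machine $\Psi$: Step 1: take the greatest $i$ with $\nu_i\in\mathcal{S}$ (stop if none); if $\nu_{i+1}$ exists, is in $\mathcal{P}$ and $\beta(\nu_i)\not\succ\nu_{i+1}$, replace $(\nu_i,\nu_{i+1})$ by $(\nu_{i+1}+1,\nu_i-1)$ (each part keeps its identity) and redo Step 1; otherwise go to Step 2. Step 2: replace the last secondary part $\nu_i$ by the two primary parts $\alpha(\nu_i),\beta(\nu_i)$; go to Step 1. $\Psi(\nu)$ is the final sequence, consisting of $p+2s$ primary parts. Expanded indexing: $\nu=(\nu_1,\ldots,\nu_{p+2s})$ obtained by replacing each secondary part in place by its upper half then lower half; $J$ = indices of primary parts, $I$ = indices of upper halves. The primary part of $\Psi(\nu)$ originating from $\nu_x$ is: for $x\in J$, the part $\nu_x$ (after its crossings); for $x\in I$ (resp. $x\in I+1$), the part $\alpha$ (resp. $\beta$) produced when the secondary part with halves $\nu_x,\nu_{x+1}$ (resp. $\nu_{x-1},\nu_x$) splits. -}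

module Defs where

open import Data.Nat as ℕ using (ℕ; zero; suc; _<ᵇ_; _≤ᵇ_; _≡ᵇ_)
open import Data.Integer as ℤ using (ℤ; +_)
open import Data.Integer.DivMod using (_/ℕ_; _%ℕ_)
open import Data.Bool using (Bool; true; false; if_then_else_; _∧_; _∨_)
open import Data.List using (List; []; _∷_; _++_)
open import Data.List.Relation.Unary.All using (All)
open import Data.List.Relation.Unary.Any using (Any)
open import Data.List.Relation.Unary.Linked using (Linked)
open import Data.Product using (_×_; _,_; ∃)
open import Data.Sum using (_⊎_)
open import Data.Unit using (⊤)
open import Data.Empty using (⊥)
open import Relation.Nullary using (¬_)
open import Relation.Binary.PropositionalEquality using (_≡_)
open import Relation.Binary.Construct.Closure.ReflexiveTransitive using (Star)

-- Colors.  Indices are 0-based: prim i is a_{i+1}, sec i j is a_{i+1}a_{j+1}.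

data Color : Set where
  prim : ℕ → Color
  sec  : ℕ → ℕ → Color

ValidColor : ℕ → Color → Set
ValidColor n (prim i)  = i ℕ.< n
ValidColor n (sec i j) = i ℕ.< j × j ℕ.< n

-- The total order  a1a2 < ... < a1an < a1 < a2a3 < ... < a2an < a2 < ... < an
-- (as a boolean test p ≤ q).
_≤ᶜ_ : Color → Color → Bool
prim i  ≤ᶜ prim i'    = i ≤ᵇ i'
prim i  ≤ᶜ sec i' j'  = i <ᵇ i'
sec i j ≤ᶜ prim i'    = i ≤ᵇ i'
sec i j ≤ᶜ sec i' j'  = (i <ᵇ i') ∨ ((i ≡ᵇ i') ∧ (j ≤ᵇ j'))

χ : Color → Color → ℕ
χ p q = if p ≤ᶜ q then 1 else 0

record Part : Set where
  constructor _▹_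
  field
    size  : ℤ
    color : Color
open Part public

_+ᵖ_ : Part → ℤ → Part
(k ▹ p) +ᵖ m = (k ℤ.+ m) ▹ p

_≻_ : Part → Part → Set
(k ▹ p) ≻ (l ▹ q) = + χ p q ℤ.≤ k ℤ.- l

_⪰_ : Part → Part → Set
x ⪰ y = x ≻ y ⊎ x ≡ y

Special : Color → Color → Set
Special (sec k l) (sec i j) = (i ℕ.< j × j ℕ.< k × k ℕ.< l) ⊎ (k ℕ.< i × i ℕ.< j × j ℕ.< l)
Special _ _ = ⊥

_≫_ : Part → Part → Set
(k ▹ sec a b) ≫ (l ▹ sec c d) =
    (Special (sec a b) (sec c d) × (k ▹ sec a b) ≻ (l ▹ sec c d))
  ⊎ (¬ Special (sec a b) (sec c d) × (k ▹ sec a b) ≻ ((l ℤ.+ + 1) ▹ sec c d))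
(k ▹ p) ≫ (l ▹ q) = (k ▹ p) ⪰ ((l ℤ.+ + 1) ▹ q)

IsPrimC : Color → Set
IsPrimC (prim _)  = ⊤
IsPrimC (sec _ _) = ⊥

IsSecC : Color → Set
IsSecC (prim _)  = ⊥
IsSecC (sec _ _) = ⊤

In𝒫 : ℕ → Part → Set
In𝒫 n (k ▹ p) = IsPrimC p × ValidColor n p × + 1 ℤ.≤ k

In𝒮 : ℕ → Part → Set
In𝒮 n (k ▹ p) = IsSecC p × ValidColor n p × + 2 ℤ.≤ k

Inℰ : ℕ → List Part → Set
Inℰ n ν = All (λ x → In𝒫 n x ⊎ In𝒮 n x) ν × Linked _≫_ ν

-- Halves of a secondary part (for a primary part, irrelevant: identity).
-- Size k = 2m + r with m = ⌊k/2⌋, r = k mod 2.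

α : Part → Part
α (k ▹ sec i j) with k %ℕ 2
... | 0 = (k /ℕ 2) ▹ prim j
... | _ = ((k /ℕ 2) ℤ.+ + 1) ▹ prim i
α x = x

β : Part → Part
β (k ▹ sec i j) with k %ℕ 2
... | 0 = (k /ℕ 2) ▹ prim i
... | _ = (k /ℕ 2) ▹ prim j
β x = x

-- Parts tagged with their origin index (expanded indexing).

record TPart : Set where
  constructor tp
  field
    part : Part
    tag  : ℕ
open TPart public

IsPrimT : TPart → Set
IsPrimT t = IsPrimC (color (part t))

IsSecT : TPart → Set
IsSecT t = IsSecC (color (part t))

-- Expanded indexing starting at index c: a primary part occupies index c,
-- a secondary part occupies c (upper half) and c+1 (lower half); the
-- secondary part is tagged with its upper-half index c.
expand : ℕ → List Part → List TPart
expand c [] = []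
expand c ((k ▹ prim i) ∷ xs)  = tp (k ▹ prim i) c ∷ expand (suc c) xs
expand c ((k ▹ sec i j) ∷ xs) = tp (k ▹ sec i j) c ∷ expand (suc (suc c)) xs

-- I : indices of upper halves ; J : indices of primary parts (1-based).
InI : List Part → ℕ → Set
InI ν x = Any (λ t → IsSecT t × tag t ≡ x) (expand 1 ν)

InJ : List Part → ℕ → Set
InJ ν x = Any (λ t → IsPrimT t × tag t ≡ x) (expand 1 ν)

-- The machine Ψ, as a one-step relation on tagged sequences.
-- A step acts on the last secondary part s (all parts after it primary).

-- "otherwise" condition of Step 1: no next part, or β(s) ≻ next part.
NoCross : TPart → List TPart → Set
NoCross s []      = ⊤
NoCross s (q ∷ _) = β (part s) ≻ part q

data Step : List TPart → List TPart → Set where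
  cross : ∀ pre s q post → IsSecT s → IsPrimT q → All IsPrimT post →
          ¬ (β (part s) ≻ part q) →
          Step (pre ++ s ∷ q ∷ post)
               (pre ++ tp (part q +ᵖ (+ 1)) (tag q) ∷ tp (part s +ᵖ (ℤ.- (+ 1))) (tag s) ∷ post)
  split : ∀ pre s post → IsSecT s → All IsPrimT post → NoCross s post →
          Step (pre ++ s ∷ post)
               (pre ++ tp (α (part s)) (tag s) ∷ tp (β (part s)) (suc (tag s)) ∷ post)

-- ψ is the output of Ψ on ν: the machine runs from ν to ψ and stops
-- (no secondary part left).
ΨRun : List Part → List TPart → Set
ΨRun ν ψ = Star Step (expand 1 ν) ψ × All IsPrimT ψ

-- θ: 1-based position in ψ of the (first) part with tag x.
position : ℕ → List TPart → ℕ
position x [] = 1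
position x (t ∷ ts) = if tag t ≡ᵇ x then 1 else suc (position x ts)

-- Ψ always acts on the last secondary part, so it is modelled by a function Ψ-from that processes
-- ν from the right: a secondary part slides through the (already primary) output for the rest of ν
-- and then splits.  Ψ is deterministic, so Ψ(ν) is this model (ΨRun⇒Ψ-from).
-- The heart of the proof is that a sliding secondary part never crosses a lower half
-- (lower-halves-never-crossed).  Its arithmetic core, lower-half-not-crossed, says that if s ≫ s'
-- and s crosses α(s'), then β(s - 1) ≻ β(s'); a parity analysis of the halves reduces this to two
-- inequalities between colours (gap-even, gap-odd).
-- Hence each part added in front of a suffix of ν inserts its tags into the output in a controlled
-- way: a primary tag first, the two halves of a secondary part side by side after a prefix
-- containing no lower half.  The statement, phrased for position functions (Invariant), survives
-- both insertions (relocate, invariant-primary, invariant-secondary), so it holds for Ψ(ν).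
module Submission where

open import Defs
open import Data.Nat using (ℕ; suc; _<_; _≤_)
open import Data.List using (List)
open import Data.Product using (_×_; _,_; proj₁; proj₂; Σ)
open import Data.Sum using (_⊎_; inj₁; inj₂)
open import Data.Nat as ℕ using (z≤n; s≤s; _≤ᵇ_; _<ᵇ_; _≡ᵇ_)
import Data.Nat.Properties as ℕP
import Data.Nat.DivMod as ℕD
open import Data.Integer as ℤ using (ℤ; +_; -[1+_]; _+_; _-_; -_; +≤+)
import Data.Integer.Properties as ℤP
open import Data.Integer.DivMod using (_/ℕ_; _%ℕ_; a≡a%ℕn+[a/ℕn]*n; n%ℕd<d)
open import Data.Integer.Tactic.RingSolver using (solve-∀)
open import Data.Bool using (Bool; true; false; T; if_then_else_)
open import Data.Bool.Properties using (T-≡)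
open import Data.Empty using (⊥; ⊥-elim)
open import Data.Unit using (⊤; tt)
open import Data.Maybe using (just)
open import Data.Maybe.Relation.Binary.Connected using (Connected; just; just-nothing)
open import Data.List as List using ([]; _∷_; _++_; map; length)
open import Data.List.Properties using (∷-injective)
open import Data.List.Relation.Unary.All using (All; []; _∷_; head)
import Data.List.Relation.Unary.All as All
import Data.List.Relation.Unary.All.Properties as AllP
open import Data.List.Relation.Unary.Any using (Any; here; there)
open import Data.List.Relation.Unary.Linked using (Linked; _∷_; head′)
import Data.List.Relation.Unary.Linked as Linked
open import Data.List.Membership.Propositional using (_∈_; _∉_)
open import Data.List.Membership.DecPropositional ℕP._≟_ using (_∈?_)
open import Function.Bundles using (Equivalence)
open import Relation.Nullary using (¬_; Dec; yes; no)
open import Relation.Nullary.Decidable using (_×-dec_; _⊎-dec_)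
open import Relation.Binary.PropositionalEquality using (_≡_; _≢_; refl; sym; trans; cong; subst)
open import Relation.Binary.Construct.Closure.ReflexiveTransitive using (Star; ε; _◅_; _◅◅_; gmap)

twice : ∀ m → m ℕ.* 2 ≡ m ℕ.+ m
twice m = trans (ℕP.*-comm m 2) (cong (m ℕ.+_) (ℕP.+-identityʳ m))

halve-even : ∀ m → (m ℕ.+ m) ℕ.% 2 ≡ 0 × (m ℕ.+ m) ℕ./ 2 ≡ m
halve-even m rewrite sym (twice m) = ℕD.m*n%n≡0 m 2 , ℕD.m*n/n≡m m 2

halve-odd : ∀ m → suc (m ℕ.+ m) ℕ.% 2 ≡ 1 × suc (m ℕ.+ m) ℕ./ 2 ≡ m
halve-odd m rewrite sym (twice m) =
  ℕD.[m+kn]%n≡m%n 1 m 2 ,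
  trans (ℕD.+-distrib-/ 1 (m ℕ.* 2) no-carry) (ℕD.m*n/n≡m m 2)
  where no-carry : 1 ℕ.+ (m ℕ.* 2) ℕ.% 2 < 2
        no-carry = subst (λ r → 1 ℕ.+ r < 2) (sym (ℕD.m*n%n≡0 m 2)) ℕP.≤-refl

halveℤ-even : ∀ q → (q + q) %ℕ 2 ≡ 0 × (q + q) /ℕ 2 ≡ q
halveℤ-even (+ m) = proj₁ (halve-even m) , cong +_ (proj₂ (halve-even m))
halveℤ-even -[1+ m ] rewrite proj₁ (halve-even m) = refl , cong (λ n → - (+ n)) halved
  where halved : suc (suc (m ℕ.+ m)) ℕ./ 2 ≡ suc m
        halved = trans (cong (λ n → suc n ℕ./ 2) (sym (ℕP.+-suc m m))) (proj₂ (halve-even (suc m)))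

halveℤ-odd : ∀ q → (q + q + + 1) %ℕ 2 ≡ 1 × (q + q + + 1) /ℕ 2 ≡ q
halveℤ-odd (+ m) rewrite ℕP.+-comm (m ℕ.+ m) 1 =
  proj₁ (halve-odd m) , cong +_ (proj₂ (halve-odd m))
halveℤ-odd -[1+ m ] rewrite proj₁ (halve-odd m) | proj₂ (halve-odd m) = refl , refl

data Parity : ℤ → Set where
  even : ∀ q → Parity (q + q)
  odd  : ∀ q → Parity (q + q + + 1)

parity : ∀ x → Parity x
parity x with x %ℕ 2 | a≡a%ℕn+[a/ℕn]*n x 2 | n%ℕd<d x 2
... | 0 | x≡ | _ = subst Parity (sym (trans x≡ (double (x /ℕ 2)))) (even (x /ℕ 2))
  where double : ∀ h → + 0 + h ℤ.* + 2 ≡ h + h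
        double = solve-∀
... | 1 | x≡ | _ = subst Parity (sym (trans x≡ (double+1 (x /ℕ 2)))) (odd (x /ℕ 2))
  where double+1 : ∀ h → + 1 + h ℤ.* + 2 ≡ h + h + + 1
        double+1 = solve-∀
... | suc (suc _) | _ | s≤s (s≤s ())

halves-even : ∀ q a b → α ((q + q) ▹ sec a b) ≡ q ▹ prim b
                      × β ((q + q) ▹ sec a b) ≡ q ▹ prim a
halves-even q a b rewrite proj₁ (halveℤ-even q) | proj₂ (halveℤ-even q) = refl , refl

halves-odd : ∀ q a b → α ((q + q + + 1) ▹ sec a b) ≡ (q + + 1) ▹ prim a
                     × β ((q + q + + 1) ▹ sec a b) ≡ q ▹ prim b
halves-odd q a b rewrite proj₁ (halveℤ-odd q) | proj₂ (halveℤ-odd q) = refl , refl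

≤ᵇ⇒≤ : ∀ {m n} → (m ≤ᵇ n) ≡ true → m ≤ n
≤ᵇ⇒≤ {m} {n} e = ℕP.≤ᵇ⇒≤ m n (subst T (sym e) _)

≤ᵇ≡false⇒> : ∀ {m n} → (m ≤ᵇ n) ≡ false → n < m
≤ᵇ≡false⇒> {m} {n} e = ℕP.≰⇒> (λ m≤n → subst T e (ℕP.≤⇒≤ᵇ m≤n))

<ᵇ⇒< : ∀ {m n} → (m <ᵇ n) ≡ true → m < n
<ᵇ⇒< {m} {n} e = ℕP.<ᵇ⇒< m n (subst T (sym e) _)

<ᵇ≡false⇒≥ : ∀ {m n} → (m <ᵇ n) ≡ false → n ≤ m
<ᵇ≡false⇒≥ {m} {n} e = ℕP.≮⇒≥ (λ m<n → subst T e (ℕP.<⇒<ᵇ m<n))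

≡ᵇ⇒≡ : ∀ {m n} → (m ≡ᵇ n) ≡ true → m ≡ n
≡ᵇ⇒≡ {m} {n} e = ℕP.≡ᵇ⇒≡ m n (subst T (sym e) _)

≡ᵇ≡false⇒≢ : ∀ {m n} → (m ≡ᵇ n) ≡ false → m ≢ n
≡ᵇ≡false⇒≢ {m} {n} e m≡n = subst T e (ℕP.≡⇒≡ᵇ m n m≡n)

sec-≤ᶜ : ∀ a0 b0 a b → (sec a0 b0 ≤ᶜ sec a b) ≡ true → a0 ≤ a
sec-≤ᶜ a0 b0 a b e with a0 <ᵇ a in lt | a0 ≡ᵇ a in eq
... | true  | _    = ℕP.<⇒≤ (<ᵇ⇒< lt)
... | false | true = ℕP.≤-reflexive (≡ᵇ⇒≡ eq)
sec-≤ᶜ a0 b0 a b () | false | false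

sec-≰ᶜ : ∀ a0 b0 a b → (sec a0 b0 ≤ᶜ sec a b) ≡ false → a < a0 ⊎ (a0 ≡ a × b < b0)
sec-≰ᶜ a0 b0 a b e with a0 <ᵇ a in lt | a0 ≡ᵇ a in eq | b0 ≤ᵇ b in le
sec-≰ᶜ a0 b0 a b () | true  | _    | _
... | false | false | _     =
  inj₁ (ℕP.≤∧≢⇒< (<ᵇ≡false⇒≥ lt) (λ a≡a0 → ≡ᵇ≡false⇒≢ eq (sym a≡a0)))
sec-≰ᶜ a0 b0 a b () | false | true | true
... | false | true  | false = inj₂ (≡ᵇ⇒≡ eq , ≤ᵇ≡false⇒> le)

χ-≤-positive : ∀ p q k → + χ p q ℤ.≤ + suc k
χ-≤-positive p q k = bounded (p ≤ᶜ q)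
  where bounded : ∀ b → + (if b then 1 else 0) ℤ.≤ + suc k
        bounded true  = +≤+ (s≤s z≤n)
        bounded false = +≤+ z≤n

χ-zero : ∀ p q → + χ p q ℤ.≤ + 0 → (p ≤ᶜ q) ≡ false
χ-zero p q = vanishes (p ≤ᶜ q)
  where vanishes : ∀ b → + (if b then 1 else 0) ℤ.≤ + 0 → b ≡ false
        vanishes false _ = refl
        vanishes true (+≤+ ())

χ-prim-zero : ∀ {m n} → n < m → + χ (prim m) (prim n) ℤ.≤ + 0
χ-prim-zero {m} {n} n<m with m ≤ᵇ n in le
... | false = +≤+ z≤n
... | true  = ⊥-elim (ℕP.<⇒≱ n<m (≤ᵇ⇒≤ le))

-- For secondary colours, (x0)_{a0 b0} ≫ x_{a b} only depends on the difference D = x0 - x;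
-- SecGap D a0 b0 a b is that condition.
SecGap : ℤ → ℕ → ℕ → ℕ → ℕ → Set
SecGap D a0 b0 a b =
    (Special (sec a0 b0) (sec a b) × + χ (sec a0 b0) (sec a b) ℤ.≤ D)
  ⊎ (¬ Special (sec a0 b0) (sec a b) × + χ (sec a0 b0) (sec a b) ℤ.≤ D - + 1)

gap-of-≫ : ∀ {x0 a0 b0 x a b} → (x0 ▹ sec a0 b0) ≫ (x ▹ sec a b) → SecGap (x0 - x) a0 b0 a b
gap-of-≫ (inj₁ special) = inj₁ special
gap-of-≫ {x0} {a0} {b0} {x} {a} {b} (inj₂ (ns , le)) =
  inj₂ (ns , subst (+ χ (sec a0 b0) (sec a b) ℤ.≤_) (shift x0 x) le)
  where shift : ∀ x0 x → x0 - (x + + 1) ≡ x0 - x - + 1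
        shift = solve-∀

≫-of-gap : ∀ {x0 a0 b0 x a b} → SecGap (x0 - x) a0 b0 a b → (x0 ▹ sec a0 b0) ≫ (x ▹ sec a b)
≫-of-gap (inj₁ special) = inj₁ special
≫-of-gap {x0} {a0} {b0} {x} {a} {b} (inj₂ (ns , le)) =
  inj₂ (ns , subst (+ χ (sec a0 b0) (sec a b) ℤ.≤_) (shift x0 x) le)
  where shift : ∀ x0 x → x0 - x - + 1 ≡ x0 - (x + + 1)
        shift = solve-∀

≫-lowered : ∀ {x0 a0 b0 x a b} → (x0 ▹ sec a0 b0) ≫ (x ▹ sec a b) →
            ((x0 + - (+ 1)) ▹ sec a0 b0) ≫ ((x + - (+ 1)) ▹ sec a b)
≫-lowered {x0} {a0} {b0} {x} {a} {b} dom =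
  ≫-of-gap {x0 + - (+ 1)} {a0} {b0} {x + - (+ 1)} {a} {b}
    (subst (λ D → SecGap D a0 b0 a b) (same x0 x) (gap-of-≫ {x0} {a0} {b0} {x} {a} {b} dom))
  where same : ∀ x0 x → x0 - x ≡ (x0 + - (+ 1)) - (x + - (+ 1))
        same = solve-∀

gap-negative : ∀ {k a0 b0 a b} → ¬ SecGap -[1+ k ] a0 b0 a b
gap-negative (inj₁ (_ , ()))
gap-negative (inj₂ (_ , ()))

gap-zero : ∀ {a0 b0 a b} → SecGap (+ 0) a0 b0 a b →
           Special (sec a0 b0) (sec a b) × (sec a0 b0 ≤ᶜ sec a b) ≡ false
gap-zero {a0} {b0} {a} {b} (inj₁ (special , χ≤0)) = special , χ-zero (sec a0 b0) (sec a b) χ≤0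
gap-zero (inj₂ (_ , ()))

gap-one : ∀ {a0 b0 a b} → SecGap (+ 1) a0 b0 a b →
          Special (sec a0 b0) (sec a b) ⊎ (sec a0 b0 ≤ᶜ sec a b) ≡ false
gap-one (inj₁ (special , _)) = inj₁ special
gap-one {a0} {b0} {a} {b} (inj₂ (_ , χ≤0)) = inj₂ (χ-zero (sec a0 b0) (sec a b) χ≤0)

gap-even : ∀ e a0 b0 a b → SecGap (e + e) a0 b0 a b → + χ (prim a0) (prim b) ℤ.≤ e
gap-even -[1+ k ] a0 b0 a b g = ⊥-elim (gap-negative g)
gap-even (+ suc k) a0 b0 a b g = χ-≤-positive (prim a0) (prim b) k
gap-even (+ 0) a0 b0 a b g with gap-zero g
... | inj₁ (_ , b<a0 , _) , _ = χ-prim-zero b<a0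
... | inj₂ (a0<a , _) , ≰ with sec-≰ᶜ a0 b0 a b ≰
...   | inj₁ a<a0       = ⊥-elim (ℕP.<-asym a0<a a<a0)
...   | inj₂ (refl , _) = ⊥-elim (ℕP.<-irrefl refl a0<a)

gap-odd : ∀ e a0 b0 a b → SecGap (e + e + + 1) a0 b0 a b →
          + χ (prim a0) (prim a) ℤ.≤ e ⊎ + χ (prim b0) (prim b) ℤ.≤ e
gap-odd -[1+ k ] a0 b0 a b g = ⊥-elim (gap-negative g)
gap-odd (+ suc k) a0 b0 a b g = inj₁ (χ-≤-positive (prim a0) (prim a) k)
gap-odd (+ 0) a0 b0 a b g with gap-one g
... | inj₁ (inj₁ (a<b , b<a0 , _)) = inj₁ (χ-prim-zero (ℕP.<-trans a<b b<a0))
... | inj₁ (inj₂ (_ , _ , b<b0))   = inj₂ (χ-prim-zero b<b0)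
... | inj₂ ≰ with sec-≰ᶜ a0 b0 a b ≰
...   | inj₁ a<a0       = inj₁ (χ-prim-zero a<a0)
...   | inj₂ (_ , b<b0) = inj₂ (χ-prim-zero b<b0)

-- Lowering a secondary part by one flips the parity of its size.
β-lowered-even : ∀ q a b → β ((q + q + - (+ 1)) ▹ sec a b) ≡ (q - + 1) ▹ prim b
β-lowered-even q a b =
  trans (cong (λ z → β (z ▹ sec a b)) (as-odd q)) (proj₂ (halves-odd (q - + 1) a b))
  where as-odd : ∀ q → q + q + - (+ 1) ≡ (q - + 1) + (q - + 1) + + 1
        as-odd = solve-∀

β-lowered-odd : ∀ q a b → β ((q + q + + 1 + - (+ 1)) ▹ sec a b) ≡ q ▹ prim a
β-lowered-odd q a b =
  trans (cong (λ z → β (z ▹ sec a b)) (as-even q)) (proj₂ (halves-even q a b))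
  where as-even : ∀ q → q + q + + 1 + - (+ 1) ≡ q + q
        as-even = solve-∀

-- Let s ≫ s' be secondary parts. If s has to cross the upper half α(s') in Step 1
-- (β(s) ⊁ α(s')), then after that crossing s - 1 stops before the lower half: β(s - 1) ≻ β(s').
-- The four parity cases reduce to gap-even and gap-odd.
lower-half-not-crossed : ∀ x0 a0 b0 x a b → (x0 ▹ sec a0 b0) ≫ (x ▹ sec a b) →
  ¬ (β (x0 ▹ sec a0 b0) ≻ α (x ▹ sec a b)) →
  β ((x0 ▹ sec a0 b0) +ᵖ (- (+ 1))) ≻ β (x ▹ sec a b)
lower-half-not-crossed x0 a0 b0 x a b dom =
  by-parity (parity x0) (parity x) (gap-of-≫ {x0} {a0} {b0} {x} {a} {b} dom)
  where
  regap : ∀ {D D'} → D ≡ D' → SecGap D a0 b0 a b → SecGap D' a0 b0 a b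
  regap = subst (λ D → SecGap D a0 b0 a b)

  gap-oe : ∀ q0 q → (q0 + q0 + + 1) - (q + q) ≡ (q0 - q) + (q0 - q) + + 1
  gap-oe = solve-∀
  gap-ee : ∀ q0 q → (q0 + q0) - (q + q) ≡ (q0 - q) + (q0 - q)
  gap-ee = solve-∀
  gap-oo : ∀ q0 q → (q0 + q0 + + 1) - (q + q + + 1) ≡ (q0 - q) + (q0 - q)
  gap-oo = solve-∀
  gap-eo : ∀ q0 q → (q0 + q0) - (q + q + + 1) ≡ (q0 - q - + 1) + (q0 - q - + 1) + + 1
  gap-eo = solve-∀
  regroup-α : ∀ q0 q → q0 - q - + 1 ≡ q0 - (q + + 1)
  regroup-α = solve-∀
  regroup-β : ∀ q0 q → q0 - q - + 1 ≡ (q0 - + 1) - q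
  regroup-β = solve-∀

  -- Write the sizes as 2q0 + ε0 and 2q + ε.  If both are even, s never crosses α(s'); if both are
  -- odd, it always stops before β(s'); the mixed cases use gap-odd with e = q0 - q (resp. e - 1).
  by-parity : ∀ {x0 x} → Parity x0 → Parity x → SecGap (x0 - x) a0 b0 a b →
              ¬ (β (x0 ▹ sec a0 b0) ≻ α (x ▹ sec a b)) →
              β ((x0 + - (+ 1)) ▹ sec a0 b0) ≻ β (x ▹ sec a b)
  by-parity (odd q0) (even q) g crosses
    rewrite proj₂ (halves-odd q0 a0 b0) | proj₁ (halves-even q a b)
          | β-lowered-odd q0 a0 b0 | proj₂ (halves-even q a b)
    with gap-odd (q0 - q) a0 b0 a b (regap (gap-oe q0 q) g)
  ... | inj₁ stops = stops
  ... | inj₂ stays = ⊥-elim (crosses stays)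
  by-parity (even q0) (even q) g crosses
    rewrite proj₂ (halves-even q0 a0 b0) | proj₁ (halves-even q a b) =
    ⊥-elim (crosses (gap-even (q0 - q) a0 b0 a b (regap (gap-ee q0 q) g)))
  by-parity (odd q0) (odd q) g crosses
    rewrite β-lowered-odd q0 a0 b0 | proj₂ (halves-odd q a b) =
    gap-even (q0 - q) a0 b0 a b (regap (gap-oo q0 q) g)
  by-parity (even q0) (odd q) g crosses
    rewrite proj₂ (halves-even q0 a0 b0) | proj₁ (halves-odd q a b)
          | β-lowered-even q0 a0 b0 | proj₂ (halves-odd q a b)
    with gap-odd (q0 - q - + 1) a0 b0 a b (regap (gap-eo q0 q) g)
  ... | inj₁ stays = ⊥-elim (crosses (subst (+ χ (prim a0) (prim a) ℤ.≤_) (regroup-α q0 q) stays))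
  ... | inj₂ stops = subst (+ χ (prim b0) (prim b) ℤ.≤_) (regroup-β q0 q) stops

-- The triangle inequality χ(p ≤ r) ≤ χ(p ≤ c) + χ(c ≤ r) through a primary colour c, for p
-- secondary (the case needed below); it holds because ≤ᶜ is a total order.
private
  indicator : Bool → ℕ
  indicator b = if b then 1 else 0

  indicator-triangle : ∀ x y z → (x ≡ true → y ≡ false → z ≡ true) →
                       indicator x ≤ indicator y ℕ.+ indicator z
  indicator-triangle false y     z     _ = z≤n
  indicator-triangle true  true  z     _ = s≤s z≤n
  indicator-triangle true  false z     f rewrite f refl refl = s≤s z≤n

χ-triangle-prim : ∀ a0 b0 c r →
  χ (sec a0 b0) (prim r) ≤ χ (sec a0 b0) (prim c) ℕ.+ χ (prim c) (prim r)
χ-triangle-prim a0 b0 c r = indicator-triangle (a0 ≤ᵇ r) (a0 ≤ᵇ c) (c ≤ᵇ r)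
  (λ a0≤r c<a0 → Equivalence.to T-≡ (ℕP.≤⇒≤ᵇ
     (ℕP.≤-trans (ℕP.<⇒≤ (≤ᵇ≡false⇒> {a0} {c} c<a0)) (≤ᵇ⇒≤ {a0} {r} a0≤r))))

χ-triangle-sec : ∀ a0 b0 c a b →
  χ (sec a0 b0) (sec a b) ≤ χ (sec a0 b0) (prim c) ℕ.+ χ (prim c) (sec a b)
χ-triangle-sec a0 b0 c a b = indicator-triangle (sec a0 b0 ≤ᶜ sec a b) (a0 ≤ᵇ c) (c <ᵇ a)
  (λ s≤s' c<a0 → Equivalence.to T-≡
     (ℕP.<⇒<ᵇ (ℕP.<-≤-trans (≤ᵇ≡false⇒> {a0} {c} c<a0) (sec-≤ᶜ a0 b0 a b s≤s'))))

χ-bound-+ : ∀ {k k1 k2 A B} → k ≤ k1 ℕ.+ k2 →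
            + k1 ℤ.≤ A → + k2 ℤ.≤ B → + k ℤ.≤ A + B
χ-bound-+ {k} {k1} {k2} {A} {B} k≤ k1≤A k2≤B =
  ℤP.≤-trans (+≤+ k≤)
             (subst (ℤ._≤ A + B) (sym (ℤP.pos-+ k1 k2)) (ℤP.+-mono-≤ k1≤A k2≤B))

-- Size bookkeeping when s - 1 is compared with the part after the one it crossed.
private
  telescope : ∀ x0 l m → (x0 - (l + + 1)) + (l - (m + + 1)) ≡ (x0 + - (+ 1)) - (m + + 1)
  telescope = solve-∀

  one-more : ∀ x0 m → + 1 + ((x0 + - (+ 1)) - (m + + 1)) ≡ (x0 + - (+ 1)) - m
  one-more = solve-∀

special? : ∀ a0 b0 a b → Dec (Special (sec a0 b0) (sec a b))
special? a0 b0 a b = ((a ℕ.<? b) ×-dec ((b ℕ.<? a0) ×-dec (a0 ℕ.<? b0)))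
                ⊎-dec ((a0 ℕ.<? a) ×-dec ((a ℕ.<? b) ×-dec (b ℕ.<? b0)))

-- Domination passes through a primary part: if s ≫ l_c ≫ ys (c primary, s secondary),
-- then s - 1 ≫ ys.  This keeps s dominating what follows when it crosses a primary part.
≫-through-primary : ∀ x0 a0 b0 l c ys → (x0 ▹ sec a0 b0) ≫ (l ▹ prim c) →
                    Linked _≫_ ((l ▹ prim c) ∷ ys) →
                    Connected _≫_ (just ((x0 + - (+ 1)) ▹ sec a0 b0)) (List.head ys)
≫-through-primary x0 a0 b0 l c [] _ _ = just-nothing
≫-through-primary x0 a0 b0 l c ((m ▹ prim r) ∷ ys) (inj₁ s≻) (inj₁ l≻ ∷ _) =
  just (inj₁ (subst (+ χ (sec a0 b0) (prim r) ℤ.≤_) (telescope x0 l m)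
                    (χ-bound-+ (χ-triangle-prim a0 b0 c r) s≻ l≻)))
≫-through-primary x0 a0 b0 .(m + + 1) c ((m ▹ prim .c) ∷ ys) (inj₁ s≻) (inj₂ refl ∷ _) =
  just (inj₁ (subst (+ χ (sec a0 b0) (prim c) ℤ.≤_) (regroup x0 m) s≻))
  where regroup : ∀ x0 m → x0 - ((m + + 1) + + 1) ≡ (x0 + - (+ 1)) - (m + + 1)
        regroup = solve-∀
≫-through-primary x0 a0 b0 l c ((m ▹ sec a b) ∷ ys) (inj₁ s≻) (inj₁ l≻ ∷ _) =
  just (by-special (special? a0 b0 a b))
  where
  bound : + χ (sec a0 b0) (sec a b) ℤ.≤ (x0 + - (+ 1)) - (m + + 1)
  bound = subst (+ χ (sec a0 b0) (sec a b) ℤ.≤_) (telescope x0 l m)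
                (χ-bound-+ (χ-triangle-sec a0 b0 c a b) s≻ l≻)
  by-special : Dec (Special (sec a0 b0) (sec a b)) → ((x0 + - (+ 1)) ▹ sec a0 b0) ≫ (m ▹ sec a b)
  by-special (yes special) = inj₁ (special ,
    ℤP.≤-trans bound (ℤP.≤-trans (ℤP.i≤suc[i] _) (ℤP.≤-reflexive (one-more x0 m))))
  by-special (no not-special) = inj₂ (not-special , bound)
≫-through-primary x0 a0 b0 l c (_ ∷ ys) (inj₂ ()) _
≫-through-primary x0 a0 b0 l c ((m ▹ sec a b) ∷ ys) (inj₁ _) (inj₂ () ∷ _)

_≻?_ : ∀ x y → Dec (x ≻ y)
x ≻? y = + χ (color x) (color y) ℤ.≤? size x - size y

-- Processing ν from the right, every part after the current secondary
-- part is primary.  slide x a b c R: the secondary part x_{a_a a_b} with tag c moves past the parts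
-- of the primary list R that its lower half does not dominate (Step 1) and splits (Step 2).
slide : ℤ → ℕ → ℕ → ℕ → List TPart → List TPart
slide x a b c [] = tp (α (x ▹ sec a b)) c ∷ tp (β (x ▹ sec a b)) (suc c) ∷ []
slide x a b c (q ∷ r) with β (x ▹ sec a b) ≻? part q
... | yes _ = tp (α (x ▹ sec a b)) c ∷ tp (β (x ▹ sec a b)) (suc c) ∷ q ∷ r
... | no _  = tp (part q +ᵖ (+ 1)) (tag q) ∷ slide (x + - (+ 1)) a b c r

-- Ψ-from c xs: the output of Ψ on the expanded sequence expand c xs.
Ψ-from : ℕ → List Part → List TPart
Ψ-from c [] = []
Ψ-from c ((k ▹ prim a) ∷ xs)  = tp (k ▹ prim a) c ∷ Ψ-from (suc c) xs
Ψ-from c ((k ▹ sec a b) ∷ xs) = slide k a b c (Ψ-from (suc (suc c)) xs)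

α-primary : ∀ x a b → IsPrimC (color (α (x ▹ sec a b)))
α-primary x a b with x %ℕ 2
... | 0     = tt
... | suc _ = tt

β-primary : ∀ x a b → IsPrimC (color (β (x ▹ sec a b)))
β-primary x a b with x %ℕ 2
... | 0     = tt
... | suc _ = tt

slide-primary : ∀ x a b c R → All IsPrimT R → All IsPrimT (slide x a b c R)
slide-primary x a b c [] _ = α-primary x a b ∷ β-primary x a b ∷ []
slide-primary x a b c (q ∷ r) (q-prim ∷ r-prim) with β (x ▹ sec a b) ≻? part q
... | yes _ = α-primary x a b ∷ β-primary x a b ∷ q-prim ∷ r-prim
... | no _  = q-prim ∷ slide-primary (x + - (+ 1)) a b c r r-prim

Ψ-from-primary : ∀ c xs → All IsPrimT (Ψ-from c xs)
Ψ-from-primary c [] = []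
Ψ-from-primary c ((k ▹ prim a) ∷ xs)  = tt ∷ Ψ-from-primary (suc c) xs
Ψ-from-primary c ((k ▹ sec a b) ∷ xs) = slide-primary k a b c _ (Ψ-from-primary (suc (suc c)) xs)

Step-cons : ∀ t {L M} → Step L M → Step (t ∷ L) (t ∷ M)
Step-cons t (cross pre s q post sS qP postP go) = cross (t ∷ pre) s q post sS qP postP go
Step-cons t (split pre s post sS postP stop)     = split (t ∷ pre) s post sS postP stop

Steps-cons : ∀ t {L M} → Star Step L M → Star Step (t ∷ L) (t ∷ M)
Steps-cons t = gmap (t ∷_) (Step-cons t)

slide-run : ∀ x a b c R → All IsPrimT R → Star Step (tp (x ▹ sec a b) c ∷ R) (slide x a b c R)
slide-run x a b c [] _ = split [] (tp (x ▹ sec a b) c) [] tt [] tt ◅ ε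
slide-run x a b c (q ∷ r) (q-prim ∷ r-prim) with β (x ▹ sec a b) ≻? part q
... | yes stop = split [] (tp (x ▹ sec a b) c) (q ∷ r) tt (q-prim ∷ r-prim) stop ◅ ε
... | no go    = cross [] (tp (x ▹ sec a b) c) q r tt q-prim r-prim go
                 ◅ Steps-cons _ (slide-run (x + - (+ 1)) a b c r r-prim)

Ψ-from-run : ∀ c xs → Star Step (expand c xs) (Ψ-from c xs)
Ψ-from-run c [] = ε
Ψ-from-run c ((k ▹ prim a) ∷ xs) = Steps-cons _ (Ψ-from-run (suc c) xs)
Ψ-from-run c ((k ▹ sec a b) ∷ xs) =
  Steps-cons _ (Ψ-from-run (suc (suc c)) xs) ◅◅ slide-run k a b c _ (Ψ-from-primary (suc (suc c)) xs)

-- The machine is deterministic: a step acts on the last secondary part, which is unique.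
sec-not-prim : ∀ t → IsSecT t → ¬ IsPrimT t
sec-not-prim (tp (k ▹ prim a) _)  ()
sec-not-prim (tp (k ▹ sec a b) _) _ ()

secondary-not-in-primary : ∀ pre s post → IsSecT s → ¬ All IsPrimT (pre ++ s ∷ post)
secondary-not-in-primary pre s post sS allP = sec-not-prim s sS (head (AllP.++⁻ʳ pre allP))

last-secondary-unique : ∀ pre₁ s₁ post₁ pre₂ s₂ post₂ → IsSecT s₁ → IsSecT s₂ →
  All IsPrimT post₁ → All IsPrimT post₂ →
  pre₁ ++ s₁ ∷ post₁ ≡ pre₂ ++ s₂ ∷ post₂ →
  pre₁ ≡ pre₂ × s₁ ≡ s₂ × post₁ ≡ post₂
last-secondary-unique [] s₁ post₁ [] s₂ post₂ _ _ _ _ e =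
  refl , proj₁ (∷-injective e) , proj₂ (∷-injective e)
last-secondary-unique [] s₁ post₁ (_ ∷ pre₂) s₂ post₂ _ s₂S post₁P _ e =
  ⊥-elim (secondary-not-in-primary pre₂ s₂ post₂ s₂S
            (subst (All IsPrimT) (proj₂ (∷-injective e)) post₁P))
last-secondary-unique (_ ∷ pre₁) s₁ post₁ [] s₂ post₂ s₁S _ _ post₂P e =
  ⊥-elim (secondary-not-in-primary pre₁ s₁ post₁ s₁S
            (subst (All IsPrimT) (sym (proj₂ (∷-injective e))) post₂P))
last-secondary-unique (_ ∷ pre₁) s₁ post₁ (_ ∷ pre₂) s₂ post₂ s₁S s₂S post₁P post₂P e
    with ∷-injective e
... | refl , e′
  with last-secondary-unique pre₁ s₁ post₁ pre₂ s₂ post₂ s₁S s₂S post₁P post₂P e′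
...   | refl , refl , refl = refl , refl , refl

Step-deterministic : ∀ {L₁ L₂ M₁ M₂} → Step L₁ M₁ → Step L₂ M₂ → L₁ ≡ L₂ → M₁ ≡ M₂
Step-deterministic (cross pre s q post sS qP postP _) (cross pre' s' q' post' sS' qP' postP' _) e
  with last-secondary-unique pre s (q ∷ post) pre' s' (q' ∷ post') sS sS'
                             (qP ∷ postP) (qP' ∷ postP') e
... | refl , refl , refl = refl
Step-deterministic (cross pre s q post sS qP postP go) (split pre' s' post' sS' postP' stop) e
  with last-secondary-unique pre s (q ∷ post) pre' s' post' sS sS' (qP ∷ postP) postP' e
... | refl , refl , refl = ⊥-elim (go stop)
Step-deterministic (split pre s post sS postP stop) (cross pre' s' q' post' sS' qP' postP' go) e
  with last-secondary-unique pre s post pre' s' (q' ∷ post') sS sS' postP (qP' ∷ postP') e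
... | refl , refl , refl = ⊥-elim (go stop)
Step-deterministic (split pre s post sS postP _) (split pre' s' post' sS' postP' _) e
  with last-secondary-unique pre s post pre' s' post' sS sS' postP postP' e
... | refl , refl , refl = refl

primary-final : ∀ {L M} → All IsPrimT L → ¬ Step L M
primary-final LP (cross pre s q post sS _ _ _) = secondary-not-in-primary pre s (q ∷ post) sS LP
primary-final LP (split pre s post sS _ _)     = secondary-not-in-primary pre s post sS LP

final-unique : ∀ {L M₁ M₂} → Star Step L M₁ → Star Step L M₂ →
               All IsPrimT M₁ → All IsPrimT M₂ → M₁ ≡ M₂
final-unique ε ε _ _ = refl
final-unique ε (step ◅ _) M₁-prim _ = ⊥-elim (primary-final M₁-prim step)
final-unique (step ◅ _) ε _ M₂-prim = ⊥-elim (primary-final M₂-prim step)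
final-unique (step₁ ◅ run₁) (step₂ ◅ run₂) M₁-prim M₂-prim
  with Step-deterministic step₁ step₂ refl
... | refl = final-unique run₁ run₂ M₁-prim M₂-prim

ΨRun⇒Ψ-from : ∀ ν ψ → ΨRun ν ψ → ψ ≡ Ψ-from 1 ν
ΨRun⇒Ψ-from ν ψ (run , ψ-prim) = final-unique run (Ψ-from-run 1 ν) ψ-prim (Ψ-from-primary 1 ν)

-- CrossesOnly s P R: while s slides through R (Step 1, losing one at each crossing), every part
-- it crosses carries a tag satisfying P.
CrossesOnly : Part → (ℕ → Set) → List TPart → Set
CrossesOnly s P []      = ⊤
CrossesOnly s P (q ∷ r) = ¬ (β s ≻ part q) → P (tag q) × CrossesOnly (s +ᵖ (- (+ 1))) P r

record Insertion (P : ℕ → Set) (c : ℕ) (R S : List ℕ) : Set where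
  constructor insertion
  field
    prefix suffix : List ℕ
    before   : R ≡ prefix ++ suffix
    after    : S ≡ prefix ++ c ∷ suc c ∷ suffix
    prefix-P : All P prefix

insertion-cons : ∀ {P c R S t} → P t → Insertion P c R S → Insertion P c (t ∷ R) (t ∷ S)
insertion-cons {t = t} Pt (insertion A B refl refl PA) = insertion (t ∷ A) B refl refl (Pt ∷ PA)

slide-tags : ∀ {P} x a b c R → CrossesOnly (x ▹ sec a b) P R →
             Insertion P c (map tag R) (map tag (slide x a b c R))
slide-tags x a b c [] _ = insertion [] [] refl refl []
slide-tags x a b c (q ∷ r) crosses with β (x ▹ sec a b) ≻? part q
... | yes _ = insertion [] (tag q ∷ map tag r) refl refl []
... | no go =
  insertion-cons (proj₁ (crosses go)) (slide-tags (x + - (+ 1)) a b c r (proj₂ (crosses go)))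

crosses-upper-only : ∀ {P : ℕ → Set} x0 a0 b0 x a b c rest →
  (x0 ▹ sec a0 b0) ≫ (x ▹ sec a b) → P c →
  CrossesOnly (x0 ▹ sec a0 b0) P (tp (α (x ▹ sec a b)) c ∷ tp (β (x ▹ sec a b)) (suc c) ∷ rest)
crosses-upper-only x0 a0 b0 x a b c rest dom Pc crosses-α =
  Pc , λ crosses-β → ⊥-elim (crosses-β (lower-half-not-crossed x0 a0 b0 x a b dom crosses-α))

-- Let s ≫ s' be secondary and let s' cross only Q-parts of R.  Sliding s through the result of
-- sliding s' through R, it crosses the parts s' crossed (lowered in step with s', so ≫ persists),
-- possibly the upper half of s' (tag c), and never the lower half (lower-half-not-crossed).
crossesOnly-slide : ∀ {P Q : ℕ → Set} x0 a0 b0 x a b c R →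
  (x0 ▹ sec a0 b0) ≫ (x ▹ sec a b) →
  CrossesOnly (x ▹ sec a b) Q R → All (λ q → Q (tag q) → P (tag q)) R → P c →
  CrossesOnly (x0 ▹ sec a0 b0) P (slide x a b c R)
crossesOnly-slide {P} x0 a0 b0 x a b c [] dom _ _ Pc = crosses-upper-only {P} x0 a0 b0 x a b c [] dom Pc
crossesOnly-slide {P} x0 a0 b0 x a b c (q ∷ r) dom crosses′ (Q⇒P ∷ Q⇒Ps) Pc
    with β (x ▹ sec a b) ≻? part q
... | yes _ = crosses-upper-only {P} x0 a0 b0 x a b c (q ∷ r) dom Pc
... | no go = λ _ → Q⇒P (proj₁ (crosses′ go)) ,
  crossesOnly-slide (x0 + - (+ 1)) a0 b0 (x + - (+ 1)) a b c r (≫-lowered {x0} {a0} {b0} {x} {a} {b} dom)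
                    (proj₂ (crosses′ go)) Q⇒Ps Pc

-- The index sets I and J of xs in expanded indexing starting at c.
UpperIndex : ℕ → List Part → ℕ → Set
UpperIndex c [] i = ⊥
UpperIndex c ((k ▹ prim _) ∷ xs)  i = UpperIndex (suc c) xs i
UpperIndex c ((k ▹ sec _ _) ∷ xs) i = i ≡ c ⊎ UpperIndex (suc (suc c)) xs i

PrimaryIndex : ℕ → List Part → ℕ → Set
PrimaryIndex c [] j = ⊥
PrimaryIndex c ((k ▹ prim _) ∷ xs)  j = j ≡ c ⊎ PrimaryIndex (suc c) xs j
PrimaryIndex c ((k ▹ sec _ _) ∷ xs) j = PrimaryIndex (suc (suc c)) xs j

UpperIndex-≥ : ∀ c xs i → UpperIndex c xs i → c ≤ i
UpperIndex-≥ c ((k ▹ prim _) ∷ xs)  i later = ℕP.<⇒≤ (UpperIndex-≥ (suc c) xs i later)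
UpperIndex-≥ c ((k ▹ sec _ _) ∷ xs) i (inj₁ refl)  = ℕP.≤-refl
UpperIndex-≥ c ((k ▹ sec _ _) ∷ xs) i (inj₂ later) =
  ℕP.≤-trans (ℕP.n≤1+n c) (ℕP.<⇒≤ (UpperIndex-≥ (suc (suc c)) xs i later))

PrimaryIndex-≥ : ∀ c xs j → PrimaryIndex c xs j → c ≤ j
PrimaryIndex-≥ c ((k ▹ prim _) ∷ xs)  j (inj₁ refl)  = ℕP.≤-refl
PrimaryIndex-≥ c ((k ▹ prim _) ∷ xs)  j (inj₂ later) =
  ℕP.<⇒≤ (PrimaryIndex-≥ (suc c) xs j later)
PrimaryIndex-≥ c ((k ▹ sec _ _) ∷ xs) j later =
  ℕP.≤-trans (ℕP.n≤1+n c) (ℕP.<⇒≤ (PrimaryIndex-≥ (suc (suc c)) xs j later))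

InI⇒UpperIndex : ∀ c xs i → Any (λ t → IsSecT t × tag t ≡ i) (expand c xs) →
                 UpperIndex c xs i
InI⇒UpperIndex c ((k ▹ prim _) ∷ xs)  i (here (() , _))
InI⇒UpperIndex c ((k ▹ prim _) ∷ xs)  i (there p)      = InI⇒UpperIndex (suc c) xs i p
InI⇒UpperIndex c ((k ▹ sec _ _) ∷ xs) i (here (_ , e)) = inj₁ (sym e)
InI⇒UpperIndex c ((k ▹ sec _ _) ∷ xs) i (there p) =
  inj₂ (InI⇒UpperIndex (suc (suc c)) xs i p)

InJ⇒PrimaryIndex : ∀ c xs j → Any (λ t → IsPrimT t × tag t ≡ j) (expand c xs) →
                   PrimaryIndex c xs j
InJ⇒PrimaryIndex c ((k ▹ prim _) ∷ xs)  j (here (_ , e)) = inj₁ (sym e)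
InJ⇒PrimaryIndex c ((k ▹ prim _) ∷ xs)  j (there p)      = inj₂ (InJ⇒PrimaryIndex (suc c) xs j p)
InJ⇒PrimaryIndex c ((k ▹ sec _ _) ∷ xs) j (here (() , _))
InJ⇒PrimaryIndex c ((k ▹ sec _ _) ∷ xs) j (there p)      = InJ⇒PrimaryIndex (suc (suc c)) xs j p

NotLowerHalf : ℕ → List Part → ℕ → Set
NotLowerHalf c xs t = ¬ (Σ ℕ λ i → UpperIndex c xs i × t ≡ suc i)

slide-All : ∀ {P : ℕ → Set} x a b c R → P c → P (suc c) → All (λ q → P (tag q)) R →
            All (λ q → P (tag q)) (slide x a b c R)
slide-All x a b c [] Pc Pc+1 _ = Pc ∷ Pc+1 ∷ []
slide-All x a b c (q ∷ r) Pc Pc+1 (Pq ∷ Pr) with β (x ▹ sec a b) ≻? part q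
... | yes _ = Pc ∷ Pc+1 ∷ Pq ∷ Pr
... | no _  = Pq ∷ slide-All (x + - (+ 1)) a b c r Pc Pc+1 Pr

Ψ-from-tags-≥ : ∀ c xs → All (λ q → c ≤ tag q) (Ψ-from c xs)
Ψ-from-tags-≥ c [] = []
Ψ-from-tags-≥ c ((k ▹ prim _) ∷ xs) =
  ℕP.≤-refl ∷ All.map ℕP.<⇒≤ (Ψ-from-tags-≥ (suc c) xs)
Ψ-from-tags-≥ c ((k ▹ sec a b) ∷ xs) =
  slide-All {c ≤_} k a b c _ ℕP.≤-refl (ℕP.n≤1+n c)
    (All.map (λ c+2≤ → ℕP.≤-trans (ℕP.n≤1+n c) (ℕP.<⇒≤ c+2≤)) (Ψ-from-tags-≥ (suc (suc c)) xs))

lower-halves-never-crossed : ∀ c xs → Linked _≫_ xs → ∀ x0 a0 b0 →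
  Connected _≫_ (just (x0 ▹ sec a0 b0)) (List.head xs) →
  CrossesOnly (x0 ▹ sec a0 b0) (NotLowerHalf c xs) (Ψ-from c xs)
lower-halves-never-crossed c [] _ _ _ _ _ = tt
lower-halves-never-crossed c ((k ▹ prim a) ∷ ys) linked x0 a0 b0 (just dom) =
  λ _ → primary-tag ,
  lower-halves-never-crossed (suc c) ys (Linked.tail linked) (x0 + - (+ 1)) a0 b0
                             (≫-through-primary x0 a0 b0 k a ys dom linked)
  where primary-tag : NotLowerHalf c ((k ▹ prim a) ∷ ys) c
        primary-tag (i , upper , refl) = ℕP.<-asym (UpperIndex-≥ (suc c) ys i upper) (ℕP.n<1+n i)
lower-halves-never-crossed c ((k ▹ sec a b) ∷ ys) linked x0 a0 b0 (just dom) =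
  crossesOnly-slide x0 a0 b0 k a b c _ dom
    (lower-halves-never-crossed (suc (suc c)) ys (Linked.tail linked) k a b (head′ linked))
    (All.map later-tag (Ψ-from-tags-≥ (suc (suc c)) ys))
    upper-tag
  where
  later-tag : ∀ {t} → suc (suc c) ≤ t → NotLowerHalf (suc (suc c)) ys t →
              NotLowerHalf c ((k ▹ sec a b) ∷ ys) t
  later-tag c+2≤ _ (i , inj₁ refl , refl) = ℕP.<-irrefl refl c+2≤
  later-tag _ not-lower (i , inj₂ upper , e) = not-lower (i , upper , e)
  upper-tag : NotLowerHalf c ((k ▹ sec a b) ∷ ys) c
  upper-tag (i , inj₁ refl , e) = ℕP.<-irrefl e (ℕP.n<1+n c)
  upper-tag (i , inj₂ upper , refl) =
    ℕP.<-asym (UpperIndex-≥ (suc (suc c)) ys i upper) (ℕP.<-trans (ℕP.n<1+n i) (ℕP.n<1+n (suc i)))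

-- Position (1-based) of the first occurrence of x in a list of tags (1 + length when absent);
-- θ is this position in the list of tags of ψ.
pos : ℕ → List ℕ → ℕ
pos x []       = 1
pos x (t ∷ ts) = if t ≡ᵇ x then 1 else suc (pos x ts)

position≡pos : ∀ x ψ → position x ψ ≡ pos x (map tag ψ)
position≡pos x [] = refl
position≡pos x (t ∷ ts) with tag t ≡ᵇ x
... | true  = refl
... | false = cong suc (position≡pos x ts)

pos-≥1 : ∀ x T → 1 ≤ pos x T
pos-≥1 x [] = s≤s z≤n
pos-≥1 x (t ∷ ts) with t ≡ᵇ x
... | true  = s≤s z≤n
... | false = s≤s z≤n

pos-head : ∀ x T → pos x (x ∷ T) ≡ 1
pos-head x T with x ≡ᵇ x in e
... | true  = refl
... | false = ⊥-elim (≡ᵇ≡false⇒≢ {x} e refl)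

pos-≢ : ∀ x t T → x ≢ t → pos x (t ∷ T) ≡ suc (pos x T)
pos-≢ x t T x≢t with t ≡ᵇ x in e
... | true  = ⊥-elim (x≢t (sym (≡ᵇ⇒≡ e)))
... | false = refl

pos-++-∈ : ∀ x A B → x ∈ A → pos x (A ++ B) ≡ pos x A × pos x A ≤ length A
pos-++-∈ x (t ∷ A) B (here refl) rewrite pos-head x A | pos-head x (A ++ B) = refl , s≤s z≤n
pos-++-∈ x (t ∷ A) B (there x∈A) with t ≡ᵇ x
... | true  = refl , s≤s z≤n
... | false = cong suc (proj₁ (pos-++-∈ x A B x∈A)) , s≤s (proj₂ (pos-++-∈ x A B x∈A))

pos-++-∉ : ∀ x A B → x ∉ A → pos x (A ++ B) ≡ length A ℕ.+ pos x B
pos-++-∉ x [] B _ = refl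
pos-++-∉ x (t ∷ A) B x∉ rewrite pos-≢ x t (A ++ B) (λ x≡t → x∉ (here x≡t)) =
  cong suc (pos-++-∉ x A B (λ x∈A → x∉ (there x∈A)))

-- How the position p of an old tag becomes p' when d new tags are inserted after position n:
-- it stays, or it moves by d.
Moves : ℕ → ℕ → ℕ → ℕ → Set
Moves n d p p' = p' ≡ d ℕ.+ p × n < p

Shift : ℕ → ℕ → ℕ → ℕ → Set
Shift n d p p' = (p' ≡ p × p ≤ n) ⊎ Moves n d p p'

shift-mono : ∀ {n d p p' q q'} → Shift n d p p' → Shift n d q q' → p < q → p' < q'
shift-mono (inj₁ (refl , _)) (inj₁ (refl , _)) p<q = p<q
shift-mono {d = d} (inj₁ (refl , p≤n)) (inj₂ (refl , n<q)) _ =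
  ℕP.≤-trans (s≤s p≤n) (ℕP.≤-trans n<q (ℕP.m≤n+m _ d))
shift-mono (inj₂ (refl , n<p)) (inj₁ (refl , q≤n)) p<q =
  ⊥-elim (ℕP.<-asym (ℕP.<-≤-trans p<q q≤n) n<p)
shift-mono {d = d} (inj₂ (refl , _)) (inj₂ (refl , _)) p<q = ℕP.+-monoʳ-< d p<q

shift-≤ : ∀ {n d p p'} → Shift n d p p' → p' ≤ d ℕ.+ p
shift-≤ {d = d} (inj₁ (refl , _)) = ℕP.m≤n+m _ d
shift-≤ (inj₂ (refl , _)) = ℕP.≤-refl

shift-avoids : ∀ {n d p p'} → Shift n d p p' → p' ≤ n ⊎ d ℕ.+ n < p'
shift-avoids (inj₁ (refl , p≤n)) = inj₁ p≤n
shift-avoids {d = d} (inj₂ (refl , n<p)) = inj₂ (ℕP.+-monoʳ-< d n<p)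

module _ (c : ℕ) (A B : List ℕ) where
  private
    T' : List ℕ
    T' = A ++ c ∷ suc c ∷ B

  pos-inserted-upper : c ∉ A → pos c T' ≡ suc (length A)
  pos-inserted-upper c∉A rewrite pos-++-∉ c A (c ∷ suc c ∷ B) c∉A | pos-head c (suc c ∷ B) =
    ℕP.+-comm (length A) 1

  pos-inserted-lower : suc c ∉ A → pos (suc c) T' ≡ 2 ℕ.+ length A
  pos-inserted-lower c+1∉A
    rewrite pos-++-∉ (suc c) A (c ∷ suc c ∷ B) c+1∉A
          | pos-≢ (suc c) c (suc c ∷ B) (ℕP.1+n≢n) | pos-head (suc c) B = ℕP.+-comm (length A) 2

  pos-insert-moves : ∀ x → x ∉ A → x ≢ c → x ≢ suc c →
                     Moves (length A) 2 (pos x (A ++ B)) (pos x T')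
  pos-insert-moves x x∉A x≢c x≢c+1
    rewrite pos-++-∉ x A B x∉A | pos-++-∉ x A (c ∷ suc c ∷ B) x∉A
          | pos-≢ x c (suc c ∷ B) x≢c | pos-≢ x (suc c) B x≢c+1 =
    trans (ℕP.+-suc (length A) _) (cong suc (ℕP.+-suc (length A) _)) ,
    ℕP.m<m+n (length A) (pos-≥1 x B)

  pos-insert-shift : ∀ x → x ≢ c → x ≢ suc c → Shift (length A) 2 (pos x (A ++ B)) (pos x T')
  pos-insert-shift x x≢c x≢c+1 with x ∈? A
  ... | yes x∈A =
    inj₁ (trans T'-pos (sym T-pos) , subst (_≤ length A) (sym T-pos) (proj₂ (pos-++-∈ x A B x∈A)))
    where T-pos : pos x (A ++ B) ≡ pos x A
          T-pos = proj₁ (pos-++-∈ x A B x∈A)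
          T'-pos : pos x T' ≡ pos x A
          T'-pos = proj₁ (pos-++-∈ x A (c ∷ suc c ∷ B) x∈A)
  ... | no x∉A  = inj₂ (pos-insert-moves x x∉A x≢c x≢c+1)

-- The statement of the theorem for a position function θ and index sets U (upper halves) and
-- J (primary parts), with the bounds of (c) offset by k; (e) θ i < θ (i + 1) is carried along.
record Invariant (k : ℕ) (U J : ℕ → Set) (θ : ℕ → ℕ) : Set where
  field
    pairs         : ∀ i i' → U i → U i' → i < i' →
                      (θ i < θ (suc i) × θ (suc i) < θ i' × θ i' < θ (suc i'))
                    ⊎ (θ i' < θ i × θ i < θ (suc i) × θ (suc i) < θ (suc i'))
    primaries     : ∀ j j' → J j → J j' → j < j' → θ j < θ j'
    lower-late    : ∀ i → U i → suc i ≤ θ (suc i) ℕ.+ k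
    primary-early : ∀ j → J j → θ j ℕ.+ k ≤ j
    primary-apart : ∀ i j → U i → J j → θ j < θ i ⊎ θ (suc i) < θ j
    halves        : ∀ i → U i → θ i < θ (suc i)
open Invariant

invariant-empty : ∀ k θ → Invariant k (λ _ → ⊥) (λ _ → ⊥) θ
invariant-empty k θ = record
  { pairs = λ _ _ () ; primaries = λ _ _ () ; lower-late = λ _ () ; primary-early = λ _ ()
  ; primary-apart = λ _ _ () ; halves = λ _ () }

-- The invariant for a suffix xs of ν starting at expanded index k + 1, θ read off the tags T.
InvariantFor : ℕ → List Part → List ℕ → Set
InvariantFor k xs T = Invariant k (UpperIndex (suc k) xs) (PrimaryIndex (suc k) xs) (λ y → pos y T)

-- The effect on old indices of inserting d new tags after position n: old positions shift and
-- lower halves move.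
record Relocation (n d : ℕ) (U J : ℕ → Set) (θ θ' : ℕ → ℕ) : Set where
  field
    upper   : ∀ i → U i → Shift n d (θ i) (θ' i)
    lower   : ∀ i → U i → Moves n d (θ (suc i)) (θ' (suc i))
    primary : ∀ j → J j → Shift n d (θ j) (θ' j)
open Relocation

relocate : ∀ {n d k U J θ θ'} → Relocation n d U J θ θ' →
           Invariant (d ℕ.+ k) U J θ → Invariant k U J θ'
relocate {n} {d} {k} {U} {J} {θ} {θ'} R inv = record
  { pairs = pairs′ ; primaries = primaries′ ; lower-late = lower-late′
  ; primary-early = primary-early′ ; primary-apart = primary-apart′ ; halves = halves′ }
  where
  lower-shift : ∀ i → U i → Shift n d (θ (suc i)) (θ' (suc i))
  lower-shift i Ui = inj₂ (lower R i Ui)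

  pairs′ : ∀ i i' → U i → U i' → i < i' →
             (θ' i < θ' (suc i) × θ' (suc i) < θ' i' × θ' i' < θ' (suc i'))
           ⊎ (θ' i' < θ' i × θ' i < θ' (suc i) × θ' (suc i) < θ' (suc i'))
  pairs′ i i' Ui Ui' i<i' with pairs inv i i' Ui Ui' i<i'
  ... | inj₁ (u , v , w) = inj₁ ( shift-mono (upper R i Ui) (lower-shift i Ui) u
                                , shift-mono (lower-shift i Ui) (upper R i' Ui') v
                                , shift-mono (upper R i' Ui') (lower-shift i' Ui') w)
  ... | inj₂ (u , v , w) = inj₂ ( shift-mono (upper R i' Ui') (upper R i Ui) u
                                , shift-mono (upper R i Ui) (lower-shift i Ui) v
                                , shift-mono (lower-shift i Ui) (lower-shift i' Ui') w)

  primaries′ : ∀ j j' → J j → J j' → j < j' → θ' j < θ' j'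
  primaries′ j j' Jj Jj' j<j' =
    shift-mono (primary R j Jj) (primary R j' Jj') (primaries inv j j' Jj Jj' j<j')

  lower-late′ : ∀ i → U i → suc i ≤ θ' (suc i) ℕ.+ k
  lower-late′ i Ui rewrite proj₁ (lower R i Ui) =
    subst (suc i ≤_) (offset d (θ (suc i)) k) (lower-late inv i Ui)
    where offset : ∀ d p k → p ℕ.+ (d ℕ.+ k) ≡ d ℕ.+ p ℕ.+ k
          offset d p k = trans (sym (ℕP.+-assoc p d k)) (cong (ℕ._+ k) (ℕP.+-comm p d))

  primary-early′ : ∀ j → J j → θ' j ℕ.+ k ≤ j
  primary-early′ j Jj = begin
    θ' j ℕ.+ k            ≤⟨ ℕP.+-monoˡ-≤ k (shift-≤ (primary R j Jj)) ⟩
    d ℕ.+ θ j ℕ.+ k       ≡⟨ cong (ℕ._+ k) (ℕP.+-comm d (θ j)) ⟩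
    θ j ℕ.+ d ℕ.+ k       ≡⟨ ℕP.+-assoc (θ j) d k ⟩
    θ j ℕ.+ (d ℕ.+ k)     ≤⟨ primary-early inv j Jj ⟩
    j                     ∎
    where open ℕP.≤-Reasoning

  primary-apart′ : ∀ i j → U i → J j → θ' j < θ' i ⊎ θ' (suc i) < θ' j
  primary-apart′ i j Ui Jj with primary-apart inv i j Ui Jj
  ... | inj₁ before = inj₁ (shift-mono (primary R j Jj) (upper R i Ui) before)
  ... | inj₂ after  = inj₂ (shift-mono (lower-shift i Ui) (primary R j Jj) after)

  halves′ : ∀ i → U i → θ' i < θ' (suc i)
  halves′ i Ui = shift-mono (upper R i Ui) (lower-shift i Ui) (halves inv i Ui)

-- Prepending a primary part, with tag c = k + 1, to the output of Ψ on ys: every old tag moves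
-- one place, and the new tag comes first.
invariant-primary : ∀ k l a ys T → InvariantFor (suc k) ys T →
                    InvariantFor k ((l ▹ prim a) ∷ ys) (suc k ∷ T)
invariant-primary k l a ys T inv = record
  { pairs = pairs old ; primaries = primaries′ ; lower-late = lower-late old
  ; primary-early = primary-early′ ; primary-apart = primary-apart′ ; halves = halves old }
  where
  c : ℕ
  c = suc k
  U J : ℕ → Set
  U = UpperIndex (suc c) ys
  J = PrimaryIndex (suc c) ys
  θ : ℕ → ℕ
  θ y = pos y (c ∷ T)

  J-late : ∀ j → J j → suc c ≤ j
  J-late = PrimaryIndex-≥ (suc c) ys

  moves : ∀ y → suc c ≤ y → Moves 0 1 (pos y T) (θ y)
  moves y c<y = pos-≢ y c T (λ y≡c → ℕP.<-irrefl (sym y≡c) c<y) , pos-≥1 y T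

  old : Invariant k U J θ
  old = relocate (record
    { upper   = λ i Ui → inj₂ (moves i (UpperIndex-≥ (suc c) ys i Ui))
    ; lower   = λ i Ui → moves (suc i) (ℕP.m≤n⇒m≤1+n (UpperIndex-≥ (suc c) ys i Ui))
    ; primary = λ j Jj → inj₂ (moves j (J-late j Jj)) }) inv

  first : ∀ y → suc c ≤ y → θ c < θ y
  first y c<y rewrite pos-head c T | proj₁ (moves y c<y) = s≤s (pos-≥1 y T)

  primaries′ : ∀ j j' → j ≡ c ⊎ J j → j' ≡ c ⊎ J j' → j < j' → θ j < θ j'
  primaries′ j j' (inj₁ refl) (inj₁ refl) j<j' = ⊥-elim (ℕP.<-irrefl refl j<j')
  primaries′ j j' (inj₁ refl) (inj₂ Jj')  _    = first j' (J-late j' Jj')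
  primaries′ j j' (inj₂ Jj)  (inj₁ refl) j<j' = ⊥-elim (ℕP.<-asym j<j' (J-late j Jj))
  primaries′ j j' (inj₂ Jj)  (inj₂ Jj')  j<j' = primaries old j j' Jj Jj' j<j'

  primary-early′ : ∀ j → j ≡ c ⊎ J j → θ j ℕ.+ k ≤ j
  primary-early′ j (inj₁ refl) rewrite pos-head c T = ℕP.≤-refl
  primary-early′ j (inj₂ Jj) = primary-early old j Jj

  primary-apart′ : ∀ i j → U i → j ≡ c ⊎ J j → θ j < θ i ⊎ θ (suc i) < θ j
  primary-apart′ i j Ui (inj₁ refl) = inj₁ (first i (UpperIndex-≥ (suc c) ys i Ui))
  primary-apart′ i j Ui (inj₂ Jj) = primary-apart old i j Ui Jj

-- Adding a secondary part with upper-half tag c = k + 1: its halves are inserted, after a prefix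
-- A of the parts it crossed, into the tags R of the output of Ψ on ys.  A contains no lower half
-- (lower-halves-never-crossed), so all lower halves move past the new pair.
invariant-secondary : ∀ k x a b ys {R S} →
  Insertion (NotLowerHalf (suc (suc (suc k))) ys) (suc k) R S → All (suc (suc (suc k)) ≤_) R →
  InvariantFor (suc (suc k)) ys R → InvariantFor k ((x ▹ sec a b) ∷ ys) S
invariant-secondary k x a b ys (insertion A B refl refl A-not-lower) R-late inv = record
  { pairs = pairs′ ; primaries = primaries old ; lower-late = lower-late′
  ; primary-early = primary-early old ; primary-apart = primary-apart′ ; halves = halves′ }
  where
  A-late : All (suc (suc (suc k)) ≤_) A
  A-late = AllP.++⁻ˡ A R-late
  c n : ℕ
  c = suc k
  n = length A
  U J : ℕ → Set
  U = UpperIndex (suc (suc c)) ys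
  J = PrimaryIndex (suc (suc c)) ys
  θ : ℕ → ℕ
  θ y = pos y (A ++ c ∷ suc c ∷ B)

  later : ∀ y → suc (suc c) ≤ y → y ≢ c × y ≢ suc c
  later y c+2≤y = (λ { refl → ℕP.<-irrefl refl (ℕP.<-trans (ℕP.n<1+n c) c+2≤y) })
                , (λ { refl → ℕP.<-irrefl refl c+2≤y })
  shift : ∀ y → suc (suc c) ≤ y → Shift n 2 (pos y (A ++ B)) (θ y)
  shift y c+2≤y = pos-insert-shift c A B y (proj₁ (later y c+2≤y)) (proj₂ (later y c+2≤y))

  upper-≥ : ∀ i → U i → suc (suc c) ≤ i
  upper-≥ i Ui = UpperIndex-≥ (suc (suc c)) ys i Ui
  lower-moves : ∀ i → U i → Moves n 2 (pos (suc i) (A ++ B)) (θ (suc i))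
  lower-moves i Ui =
    pos-insert-moves c A B (suc i) (λ i+1∈A → All.lookup A-not-lower i+1∈A (i , Ui , refl))
                       (proj₁ (later (suc i) (ℕP.m≤n⇒m≤1+n (upper-≥ i Ui))))
                       (proj₂ (later (suc i) (ℕP.m≤n⇒m≤1+n (upper-≥ i Ui))))

  old : Invariant k U J θ
  old = relocate (record
    { upper   = λ i Ui → shift i (upper-≥ i Ui)
    ; lower   = lower-moves
    ; primary = λ j Jj → shift j (PrimaryIndex-≥ (suc (suc c)) ys j Jj) }) inv

  θc : θ c ≡ suc n
  θc = pos-inserted-upper c A B
         (λ c∈A → ℕP.<-irrefl refl (ℕP.<-trans (ℕP.n<1+n c) (All.lookup A-late c∈A)))
  θc+1 : θ (suc c) ≡ 2 ℕ.+ n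
  θc+1 = pos-inserted-lower c A B (λ c+1∈A → ℕP.<-irrefl refl (All.lookup A-late c+1∈A))
  new-halves : θ c < θ (suc c)
  new-halves rewrite θc | θc+1 = ℕP.≤-refl
  before-or-after : ∀ y → suc (suc c) ≤ y → θ y < θ c ⊎ θ (suc c) < θ y
  before-or-after y c+2≤y rewrite θc | θc+1 with shift-avoids (shift y c+2≤y)
  ... | inj₁ y≤n   = inj₁ (s≤s y≤n)
  ... | inj₂ n+2<y = inj₂ n+2<y
  lower-after : ∀ i → U i → θ (suc c) < θ (suc i)
  lower-after i Ui rewrite θc+1 | proj₁ (lower-moves i Ui) = ℕP.+-monoʳ-< 2 (proj₂ (lower-moves i Ui))

  pairs′ : ∀ i i' → i ≡ c ⊎ U i → i' ≡ c ⊎ U i' → i < i' →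
             (θ i < θ (suc i) × θ (suc i) < θ i' × θ i' < θ (suc i'))
           ⊎ (θ i' < θ i × θ i < θ (suc i) × θ (suc i) < θ (suc i'))
  pairs′ i i' (inj₁ refl) (inj₁ refl) i<i' = ⊥-elim (ℕP.<-irrefl refl i<i')
  pairs′ i i' (inj₂ Ui)  (inj₁ refl) i<i' =
    ⊥-elim (ℕP.<-asym i<i' (ℕP.<-trans (ℕP.n<1+n c) (upper-≥ i Ui)))
  pairs′ i i' (inj₂ Ui)  (inj₂ Ui')  i<i' = pairs old i i' Ui Ui' i<i'
  pairs′ i i' (inj₁ refl) (inj₂ Ui') _ with before-or-after i' (upper-≥ i' Ui')
  ... | inj₁ nested   = inj₂ (nested , new-halves , lower-after i' Ui')
  ... | inj₂ disjoint = inj₁ (new-halves , disjoint , halves old i' Ui')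

  lower-late′ : ∀ i → i ≡ c ⊎ U i → suc i ≤ θ (suc i) ℕ.+ k
  lower-late′ i (inj₁ refl) rewrite θc+1 = s≤s (s≤s (ℕP.m≤n+m k n))
  lower-late′ i (inj₂ Ui) = lower-late old i Ui

  primary-apart′ : ∀ i j → i ≡ c ⊎ U i → J j → θ j < θ i ⊎ θ (suc i) < θ j
  primary-apart′ i j (inj₁ refl) Jj = before-or-after j (PrimaryIndex-≥ (suc (suc c)) ys j Jj)
  primary-apart′ i j (inj₂ Ui) Jj = primary-apart old i j Ui Jj

  halves′ : ∀ i → i ≡ c ⊎ U i → θ i < θ (suc i)
  halves′ i (inj₁ refl) = new-halves
  halves′ i (inj₂ Ui) = halves old i Ui

invariant-Ψ : ∀ k xs → Linked _≫_ xs → InvariantFor k xs (map tag (Ψ-from (suc k) xs))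
invariant-Ψ k [] _ = invariant-empty k _
invariant-Ψ k ((l ▹ prim a) ∷ ys) linked =
  invariant-primary k l a ys (map tag (Ψ-from (suc (suc k)) ys))
                    (invariant-Ψ (suc k) ys (Linked.tail linked))
invariant-Ψ k ((x ▹ sec a b) ∷ ys) linked =
  invariant-secondary k x a b ys
    (slide-tags x a b (suc k) _
       (lower-halves-never-crossed _ ys (Linked.tail linked) x a b (head′ linked)))
    (AllP.map⁺ (Ψ-from-tags-≥ _ ys))
    (invariant-Ψ (suc (suc k)) ys (Linked.tail linked))

-- Proposition 7.1.  Ψ(ν) is the model Ψ-from 1 ν, whose invariant at offset 0 is the statement.
proposition7p1 :
    ∀ (n : ℕ) (ν : List Part) → Inℰ n ν →
    ∀ (ψ : List TPart) → ΨRun ν ψ →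
    let θ = λ (x : ℕ) → position x ψ in
      (∀ i i' → InI ν i → InI ν i' → i < i' →
          (θ i < θ (suc i) × θ (suc i) < θ i' × θ i' < θ (suc i'))
        ⊎ (θ i' < θ i × θ i < θ (suc i) × θ (suc i) < θ (suc i')))
    × (∀ j j' → InJ ν j → InJ ν j' → j < j' → θ j < θ j')
    × (∀ i → InI ν i → suc i ≤ θ (suc i))
    × (∀ j → InJ ν j → θ j ≤ j)
    × (∀ i j → InI ν i → InJ ν j → θ j < θ i ⊎ θ (suc i) < θ j)
proposition7p1 n ν (_ , linked) ψ run rewrite ΨRun⇒Ψ-from ν ψ run =
    (λ i i' Ii Ii' → pairs inv i i' (in-I Ii) (in-I Ii'))
  , (λ j j' Jj Jj' → primaries inv j j' (in-J Jj) (in-J Jj'))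
  , (λ i Ii → subst (suc i ≤_) (ℕP.+-identityʳ _) (lower-late inv i (in-I Ii)))
  , (λ j Jj → subst (_≤ j) (ℕP.+-identityʳ _) (primary-early inv j (in-J Jj)))
  , (λ i j Ii Jj → primary-apart inv i j (in-I Ii) (in-J Jj))
  where
  ψ₀ : List TPart
  ψ₀ = Ψ-from 1 ν
  -- θ is the position among the tags: a relocation inserting no new tags.
  same : ∀ x → Moves 0 0 (pos x (map tag ψ₀)) (position x ψ₀)
  same x = position≡pos x ψ₀ , pos-≥1 x (map tag ψ₀)
  inv : Invariant 0 (UpperIndex 1 ν) (PrimaryIndex 1 ν) (λ x → position x ψ₀)
  inv = relocate (record { upper = λ i _ → inj₂ (same i) ; lower = λ i _ → same (suc i)
                         ; primary = λ j _ → inj₂ (same j) })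
                 (invariant-Ψ 0 ν linked)
  in-I : ∀ {i} → InI ν i → UpperIndex 1 ν i
  in-I = InI⇒UpperIndex 1 ν _
  in-J : ∀ {j} → InJ ν j → PrimaryIndex 1 ν j
  in-J = InJ⇒PrimaryIndex 1 ν _
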